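{- Let $\mathbf{x}$ be a sequence over a finite alphabet. Then $r_{\mathbf{x}} (n) \leq r_{\mathbf{x}} (n+2)$ for all $n \geq 0$.
   Context: A factor of a sequence is a finite contiguous block. For $u=u(1)\cdots u(m)$, $u^R=u(m)\cdots u(1)$. $r_{\mathbf{x}}(n)$ is the number of distinct length-$n$ factors of $\mathbf{x}$ up to the equivalence $u\sim v\iff v\in\{u,u^R\}$. -}

module Defs where

open import Data.Nat using (ℕ; _+_)
open import Data.Fin using (Fin; toℕ)
open import Data.Vec using (Vec; lookup; reverse)
open import Data.Product using (Σ; ∃; _×_)
open import Data.Sum using (_⊎_)
open import Relation.Binary.PropositionalEquality using (_≡_)

Seq : ℕ → Set
Seq k = ℕ → Fin k

Word : ℕ → ℕ → Set
Word k n = Vec (Fin k) n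

Factor : ∀ {k n} → Seq k → Word k n → Set
Factor x w = ∃ λ i → ∀ j → lookup w j ≡ x (i + toℕ j)

_∼_ : ∀ {k n} → Word k n → Word k n → Set
u ∼ v = (v ≡ u) ⊎ (v ≡ reverse u)

-- RCount x n m : r_x(n) = m, i.e. the length-n factors of x fall into
-- exactly m classes of ∼: there are m factors, pairwise inequivalent,
-- such that every length-n factor is equivalent to one of them.
RCount : ∀ {k} → Seq k → ℕ → ℕ → Set
RCount {k} x n m =
  Σ (Vec (Word k n) m) λ reps →
    (∀ i → Factor x (lookup reps i)) ×
    (∀ i j → lookup reps i ∼ lookup reps j → i ≡ j) ×
    (∀ (w : Word k n) → Factor x w → ∃ λ i → w ∼ lookup reps i)

{-# OPTIONS --safe #-}
module Submission where

-- Deleting the first and last letter of a length-(n+2) factor leaves a length-n factor, and this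
-- commutes with reversal, so it induces a map from the r(n+2) classes of length-(n+2) factors to
-- the r(n) classes of length-n factors.  A length-n factor at position p ≥ 1 is the middle of the
-- factor at p − 1, so the map hits every class except possibly the class of the prefix, and if it
-- misses that class while being non-injective we still get r(n) ≤ r(n+2).  If it were injective
-- and missed the prefix class, then equal classes at positions s+1 and t+1 would force equal
-- classes at s and t (or crosswise at s, t+2 and s+2, t); descending, every collision would end
-- at position 0, whose class occurs nowhere else, so the infinitely many positions would carry
-- pairwise distinct classes — impossible with finitely many classes.

open import Defs
open import Data.Nat using (ℕ; zero; suc; _+_; _∸_; _≤_; _<_; s≤s; z<s)
open import Data.Nat.Properties
  using (+-suc; +-comm; +-cancelʳ-≡; suc-injective; m∸n+n≡m; m≤m+n; m<n⇒m<1+n; n<1+n; m<n+m; m≢1+n+m)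
open import Data.Nat.Induction using (<-rec)
open import Data.Fin using (Fin; zero; suc; toℕ; fromℕ; fromℕ<; inject₁; opposite; _≟_)
open import Data.Fin.Properties
  using (toℕ-fromℕ<; toℕ<n; opposite-prop; opposite-involutive; any?; injective⇒≤; ℕ→Fin-notInjective)
open import Data.Vec using (Vec; []; _∷_; lookup; reverse; tabulate; _∷ʳ_)
open import Data.Vec.Properties using (reverse-∷; reverse-involutive; lookup∘tabulate; tabulate∘lookup; tabulate-cong)
open import Data.Product as Product using (∃; ∃₂; _×_; _,_; proj₁; proj₂)
open import Data.Sum as Sum using (_⊎_; inj₁; inj₂)
open import Data.Empty using (⊥-elim)
open import Function.Definitions using (Injective)
open import Relation.Nullary using (¬_; Dec; yes; no; ¬?)
open import Relation.Nullary.Decidable using (decidable-stable; _×-dec_)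
open import Relation.Binary.Definitions using (DecidableEquality)
open import Relation.Binary.PropositionalEquality
open ≡-Reasoning

lookup-∷ʳ-fromℕ : ∀ {A : Set} {n} (xs : Vec A n) y → lookup (xs ∷ʳ y) (fromℕ n) ≡ y
lookup-∷ʳ-fromℕ []       y = refl
lookup-∷ʳ-fromℕ (x ∷ xs) y = lookup-∷ʳ-fromℕ xs y

lookup-∷ʳ-inject₁ : ∀ {A : Set} {n} (xs : Vec A n) y i → lookup (xs ∷ʳ y) (inject₁ i) ≡ lookup xs i
lookup-∷ʳ-inject₁ (x ∷ xs) y zero    = refl
lookup-∷ʳ-inject₁ (x ∷ xs) y (suc i) = lookup-∷ʳ-inject₁ xs y i

lookup-reverse-opposite : ∀ {A : Set} {n} (xs : Vec A n) i → lookup (reverse xs) (opposite i) ≡ lookup xs i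
lookup-reverse-opposite {n = suc n} (x ∷ xs) zero = begin
  lookup (reverse (x ∷ xs)) (fromℕ n) ≡⟨ cong (λ v → lookup v (fromℕ n)) (reverse-∷ x xs) ⟩
  lookup (reverse xs ∷ʳ x) (fromℕ n)  ≡⟨ lookup-∷ʳ-fromℕ (reverse xs) x ⟩
  x                                   ∎
lookup-reverse-opposite (x ∷ xs) (suc i) = begin
  lookup (reverse (x ∷ xs)) (inject₁ (opposite i)) ≡⟨ cong (λ v → lookup v (inject₁ (opposite i))) (reverse-∷ x xs) ⟩
  lookup (reverse xs ∷ʳ x) (inject₁ (opposite i))  ≡⟨ lookup-∷ʳ-inject₁ (reverse xs) x (opposite i) ⟩
  lookup (reverse xs) (opposite i)                 ≡⟨ lookup-reverse-opposite xs i ⟩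
  lookup xs i                                      ∎

lookup-reverse : ∀ {A : Set} {n} (xs : Vec A n) i → lookup (reverse xs) i ≡ lookup xs (opposite i)
lookup-reverse xs i = begin
  lookup (reverse xs) i                       ≡⟨ cong (lookup (reverse xs)) (opposite-involutive i) ⟨
  lookup (reverse xs) (opposite (opposite i)) ≡⟨ lookup-reverse-opposite xs (opposite i) ⟩
  lookup xs (opposite i)                      ∎

suc-toℕ-opposite-+ : ∀ {m} (i : Fin m) → suc (toℕ (opposite i) + toℕ i) ≡ m
suc-toℕ-opposite-+ {m} i = begin
  suc (toℕ (opposite i) + toℕ i)  ≡⟨ +-suc (toℕ (opposite i)) (toℕ i) ⟨
  toℕ (opposite i) + suc (toℕ i)  ≡⟨ cong (_+ suc (toℕ i)) (opposite-prop i) ⟩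
  m ∸ suc (toℕ i) + suc (toℕ i)   ≡⟨ m∸n+n≡m (toℕ<n i) ⟩
  m                               ∎

toℕ-opposite : ∀ {m} (i : Fin m) {j} → suc (j + toℕ i) ≡ m → toℕ (opposite i) ≡ j
toℕ-opposite i {j} e = +-cancelʳ-≡ (toℕ i) _ j (suc-injective (trans (suc-toℕ-opposite-+ i) (sym e)))

m+[2+n]≡2+[m+n] : ∀ m n → m + (2 + n) ≡ 2 + (m + n)
m+[2+n]≡2+[m+n] m n = trans (+-suc m (suc n)) (cong suc (+-suc m n))

∼-sym : ∀ {k n} {u v : Word k n} → u ∼ v → v ∼ u
∼-sym (inj₁ v≡u)          = inj₁ (sym v≡u)
∼-sym {u = u} (inj₂ v≡uᴿ) = inj₂ (sym (trans (cong reverse v≡uᴿ) (reverse-involutive u)))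

∼-trans : ∀ {k n} {u v w : Word k n} → u ∼ v → v ∼ w → u ∼ w
∼-trans (inj₁ v≡u)          (inj₁ w≡v)  = inj₁ (trans w≡v v≡u)
∼-trans (inj₁ v≡u)          (inj₂ w≡vᴿ) = inj₂ (trans w≡vᴿ (cong reverse v≡u))
∼-trans (inj₂ v≡uᴿ)         (inj₁ w≡v)  = inj₂ (trans w≡v v≡uᴿ)
∼-trans {u = u} (inj₂ v≡uᴿ) (inj₂ w≡vᴿ) = inj₁ (trans w≡vᴿ (trans (cong reverse v≡uᴿ) (reverse-involutive u)))

-- In the crosswise case the induction hypothesis at t turns f (2 + s) ≡ f t into t ≡ 2 + s, and
-- then f s ≡ f (4 + s) contradicts the hypothesis at s < t.
injective-if-collisions-descend : ∀ {A : Set} (f : ℕ → A) →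
  (∀ s t → f (suc s) ≡ f (suc t) → f s ≡ f t ⊎ (f s ≡ f (2 + t) × f (2 + s) ≡ f t)) →
  (∀ t → f 0 ≢ f (suc t)) →
  Injective _≡_ _≡_ f
injective-if-collisions-descend f descend first-unique {s} {t} = <-rec Unique step t s
  where
  Unique : ℕ → Set
  Unique t = ∀ s → f s ≡ f t → s ≡ t

  step : ∀ t → (∀ {u} → u < t → Unique u) → Unique t
  step zero    _   zero    _ = refl
  step zero    _   (suc s) e = ⊥-elim (first-unique s (sym e))
  step (suc t) _   zero    e = ⊥-elim (first-unique t e)
  step (suc t) rec (suc s) e with descend s t e
  ... | inj₁ e′ = cong suc (rec (n<1+n t) s e′)
  ... | inj₂ (e₁ , e₂) with rec (n<1+n t) (2 + s) e₂
  ... | refl = ⊥-elim (m≢1+n+m s (sym (rec (m<n+m s z<s) (4 + s) (sym e₁))))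

surjective⇒≤ : ∀ {a b} (g : Fin b → Fin a) → (∀ i → ∃ λ j → g j ≡ i) → a ≤ b
surjective⇒≤ {a} {b} g surjective = injective⇒≤ {f = section} λ {i} {i′} same → begin
  i              ≡⟨ proj₂ (surjective i) ⟨
  g (section i)  ≡⟨ cong g same ⟩
  g (section i′) ≡⟨ proj₂ (surjective i′) ⟩
  i′             ∎
  where
  section : Fin a → Fin b
  section i = proj₁ (surjective i)

injective-or-collision : ∀ {A : Set} {b} → DecidableEquality A → (g : Fin b → A) →
  Injective _≡_ _≡_ g ⊎ ∃₂ λ j₁ j₂ → j₁ ≢ j₂ × g j₁ ≡ g j₂
injective-or-collision _≟ᴬ_ g
  with any? (λ j₁ → any? (λ j₂ → ¬? (j₁ ≟ j₂) ×-dec (g j₁ ≟ᴬ g j₂)))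
... | yes (j₁ , j₂ , collision) = inj₂ (j₁ , j₂ , collision)
... | no  no-collision = inj₁ λ {j₁} {j₂} same →
  decidable-stable (j₁ ≟ j₂) λ j₁≢j₂ → no-collision (j₁ , j₂ , j₁≢j₂ , same)

module _ {a b} (g : Fin b → Fin a) (i₀ : Fin a) (covers : ∀ i → i ≢ i₀ → ∃ λ j → g j ≡ i) where

  collision⇒≤ : ∀ {j₁ j₂} → j₁ ≢ j₂ → g j₁ ≡ g j₂ → a ≤ b
  collision⇒≤ {j₁} {j₂} j₁≢j₂ collide =
    injective⇒≤ {f = λ i → choose (i ≟ i₀)} λ {i} {i′} → choose-injective (i ≟ i₀) (i′ ≟ i₀)
    where
    preimage-avoiding-j₂ : ∀ i → i ≢ i₀ → ∃ λ j → j ≢ j₂ × g j ≡ i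
    preimage-avoiding-j₂ i i≢i₀ with covers i i≢i₀
    ... | j , gj≡i with j ≟ j₂
    ...   | yes refl = j₁ , j₁≢j₂ , trans collide gj≡i
    ...   | no  j≢j₂ = j , j≢j₂ , gj≡i

    choose : ∀ {i} → Dec (i ≡ i₀) → Fin b
    choose     (yes _)   = j₂
    choose {i} (no i≢i₀) = proj₁ (preimage-avoiding-j₂ i i≢i₀)

    choose-injective : ∀ {i i′} (d : Dec (i ≡ i₀)) (d′ : Dec (i′ ≡ i₀)) → choose d ≡ choose d′ → i ≡ i′
    choose-injective (yes refl) (yes refl) _ = refl
    choose-injective (yes _) (no i′≢i₀) same = ⊥-elim (proj₁ (proj₂ (preimage-avoiding-j₂ _ i′≢i₀)) (sym same))
    choose-injective (no i≢i₀) (yes _)  same = ⊥-elim (proj₁ (proj₂ (preimage-avoiding-j₂ _ i≢i₀)) same)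
    choose-injective {i} {i′} (no i≢i₀) (no i′≢i₀) same = begin
      i                     ≡⟨ proj₂ (proj₂ (preimage-avoiding-j₂ i i≢i₀)) ⟨
      g (choose (no i≢i₀))  ≡⟨ cong g same ⟩
      g (choose (no i′≢i₀)) ≡⟨ proj₂ (proj₂ (preimage-avoiding-j₂ i′ i′≢i₀)) ⟩
      i′                    ∎

  almost-surjective⇒≤ : (Injective _≡_ _≡_ g → ¬ ¬ ∃ λ j → g j ≡ i₀) → a ≤ b
  almost-surjective⇒≤ injective⇒hits with injective-or-collision _≟_ g
  ... | inj₂ (_ , _ , j₁≢j₂ , collide) = collision⇒≤ j₁≢j₂ collide
  ... | inj₁ g-injective = surjective⇒≤ g surjective
    where
    surjective : ∀ i → ∃ λ j → g j ≡ i
    surjective i with i ≟ i₀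
    ... | yes refl = decidable-stable (any? λ j → g j ≟ i₀) (injective⇒hits g-injective)
    ... | no i≢i₀  = covers i i≢i₀

module Occurrences {k} (x : Seq k) where

  factorAt : ℕ → (m : ℕ) → Word k m
  factorAt s m = tabulate (λ i → x (s + toℕ i))

  factorAt-Factor : ∀ s m → Factor x (factorAt s m)
  factorAt-Factor s m = s , lookup∘tabulate _

  Factor⇒≡factorAt : ∀ {m} {w : Word k m} (occ : Factor x w) → w ≡ factorAt (proj₁ occ) m
  Factor⇒≡factorAt {w = w} (_ , w≗x) = trans (sym (tabulate∘lookup w)) (tabulate-cong w≗x)

  lookup-factorAt-fromℕ< : ∀ s {m j} (j<m : j < m) → lookup (factorAt s m) (fromℕ< j<m) ≡ x (s + j)
  lookup-factorAt-fromℕ< s j<m = trans (lookup∘tabulate _ (fromℕ< j<m)) (cong (λ j → x (s + j)) (toℕ-fromℕ< j<m))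

  Agree Mirror Match : ℕ → ℕ → ℕ → Set
  Agree m s t  = ∀ j → j < m → x (s + j) ≡ x (t + j)
  Mirror m s t = ∀ j l → suc (j + l) ≡ m → x (s + j) ≡ x (t + l)
  Match m s t  = Agree m s t ⊎ Mirror m s t

  factorAt-≡⇒Agree : ∀ {m s t} → factorAt t m ≡ factorAt s m → Agree m s t
  factorAt-≡⇒Agree {m} {s} {t} e j j<m = begin
    x (s + j)                          ≡⟨ lookup-factorAt-fromℕ< s j<m ⟨
    lookup (factorAt s m) (fromℕ< j<m) ≡⟨ cong (λ w → lookup w (fromℕ< j<m)) e ⟨
    lookup (factorAt t m) (fromℕ< j<m) ≡⟨ lookup-factorAt-fromℕ< t j<m ⟩
    x (t + j)                          ∎

  Agree⇒factorAt-≡ : ∀ {m s t} → Agree m s t → factorAt t m ≡ factorAt s m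
  Agree⇒factorAt-≡ agree = tabulate-cong λ i → sym (agree (toℕ i) (toℕ<n i))

  factorAt-≡reverse⇒Mirror : ∀ {m s t} → factorAt t m ≡ reverse (factorAt s m) → Mirror m s t
  factorAt-≡reverse⇒Mirror {m} {s} {t} e j l 1+j+l≡m = begin
    x (s + j)                          ≡⟨ cong (λ j → x (s + j)) (toℕ-opposite i 1+j+i≡m) ⟨
    x (s + toℕ (opposite i))           ≡⟨ lookup∘tabulate _ (opposite i) ⟨
    lookup (factorAt s m) (opposite i) ≡⟨ lookup-reverse (factorAt s m) i ⟨
    lookup (reverse (factorAt s m)) i  ≡⟨ cong (λ w → lookup w i) e ⟨
    lookup (factorAt t m) i            ≡⟨ lookup-factorAt-fromℕ< t l<m ⟩
    x (t + l)                          ∎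
    where
    l<m : l < m
    l<m = subst (l <_) (trans (cong suc (+-comm l j)) 1+j+l≡m) (s≤s (m≤m+n l j))
    i : Fin m
    i = fromℕ< l<m
    1+j+i≡m : suc (j + toℕ i) ≡ m
    1+j+i≡m = trans (cong (λ l → suc (j + l)) (toℕ-fromℕ< l<m)) 1+j+l≡m

  Mirror⇒factorAt-≡reverse : ∀ {m s t} → Mirror m s t → factorAt t m ≡ reverse (factorAt s m)
  Mirror⇒factorAt-≡reverse {m} {s} {t} mirror = trans (tabulate-cong x∘t≗reversed) (tabulate∘lookup _)
    where
    x∘t≗reversed : ∀ i → x (t + toℕ i) ≡ lookup (reverse (factorAt s m)) i
    x∘t≗reversed i = begin
      x (t + toℕ i)                      ≡⟨ mirror (toℕ (opposite i)) (toℕ i) (suc-toℕ-opposite-+ i) ⟨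
      x (s + toℕ (opposite i))           ≡⟨ lookup∘tabulate _ (opposite i) ⟨
      lookup (factorAt s m) (opposite i) ≡⟨ lookup-reverse (factorAt s m) i ⟨
      lookup (reverse (factorAt s m)) i  ∎

  ∼⇒Match : ∀ {m s t} → factorAt s m ∼ factorAt t m → Match m s t
  ∼⇒Match = Sum.map factorAt-≡⇒Agree factorAt-≡reverse⇒Mirror

  Match⇒∼ : ∀ {m s t} → Match m s t → factorAt s m ∼ factorAt t m
  Match⇒∼ = Sum.map Agree⇒factorAt-≡ Mirror⇒factorAt-≡reverse

  Match-middle : ∀ {n s t} → Match (2 + n) s t → Match n (suc s) (suc t)
  Match-middle {n} {s} {t} (inj₁ agree) = inj₁ λ j j<n → begin
    x (suc s + j) ≡⟨ cong x (+-suc s j) ⟨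
    x (s + suc j) ≡⟨ agree (suc j) (s≤s (m<n⇒m<1+n j<n)) ⟩
    x (t + suc j) ≡⟨ cong x (+-suc t j) ⟩
    x (suc t + j) ∎
  Match-middle {n} {s} {t} (inj₂ mirror) = inj₂ λ j l 1+j+l≡n → begin
    x (suc s + j) ≡⟨ cong x (+-suc s j) ⟨
    x (s + suc j) ≡⟨ mirror (suc j) (suc l) (cong (2 +_) (trans (+-suc j l) 1+j+l≡n)) ⟩
    x (t + suc l) ≡⟨ cong x (+-suc t l) ⟩
    x (suc t + l) ∎

  Match-split : ∀ {n s t} → Match (2 + n) s t → Match n s t ⊎ (Match n s (2 + t) × Match n (2 + s) t)
  Match-split (inj₁ agree) = inj₁ (inj₁ λ j j<n → agree j (m<n⇒m<1+n (m<n⇒m<1+n j<n)))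
  Match-split {n} {s} {t} (inj₂ mirror) = inj₂ (inj₂ mirror-drop-last , inj₂ mirror-drop-first)
    where
    mirror-drop-last : Mirror n s (2 + t)
    mirror-drop-last j l 1+j+l≡n = begin
      x (s + j)       ≡⟨ mirror j (2 + l) (trans (cong suc (m+[2+n]≡2+[m+n] j l)) (cong (2 +_) 1+j+l≡n)) ⟩
      x (t + (2 + l)) ≡⟨ cong x (m+[2+n]≡2+[m+n] t l) ⟩
      x (2 + t + l)   ∎
    mirror-drop-first : Mirror n (2 + s) t
    mirror-drop-first j l 1+j+l≡n = begin
      x (2 + s + j)   ≡⟨ cong x (m+[2+n]≡2+[m+n] s j) ⟨
      x (s + (2 + j)) ≡⟨ mirror (2 + j) l (cong (2 +_) 1+j+l≡n) ⟩
      x (t + l)       ∎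

  record Classification (m c : ℕ) : Set where
    field
      class          : ℕ → Fin c
      position       : Fin c → ℕ
      class∘position : ∀ i → class (position i) ≡ i
      Match⇒class≡   : ∀ {s t} → Match m s t → class s ≡ class t
      class≡⇒Match   : ∀ {s t} → class s ≡ class t → Match m s t

  classify : ∀ {m c} → RCount x m c → Classification m c
  classify {m} {c} (reps , occurs , distinct , complete) = record
    { class          = class
    ; position       = position
    ; class∘position = class∘position
    ; Match⇒class≡   = Match⇒class≡
    ; class≡⇒Match   = class≡⇒Match
    }
    where
    class : ℕ → Fin c
    class t = proj₁ (complete (factorAt t m) (factorAt-Factor t m))

    factorAt∼class : ∀ t → factorAt t m ∼ lookup reps (class t)
    factorAt∼class t = proj₂ (complete (factorAt t m) (factorAt-Factor t m))

    position : Fin c → ℕ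
    position i = proj₁ (occurs i)

    class∘position : ∀ i → class (position i) ≡ i
    class∘position i = sym (distinct i _ (subst (_∼ lookup reps (class (position i)))
                                                 (sym (Factor⇒≡factorAt (occurs i)))
                                                 (factorAt∼class (position i))))

    Match⇒class≡ : ∀ {s t} → Match m s t → class s ≡ class t
    Match⇒class≡ {s} {t} match =
      distinct _ _ (∼-trans (∼-sym (factorAt∼class s)) (∼-trans (Match⇒∼ match) (factorAt∼class t)))

    class≡⇒Match : ∀ {s t} → class s ≡ class t → Match m s t
    class≡⇒Match {s} {t} same = ∼⇒Match (∼-trans (factorAt∼class s)
      (subst (λ i → lookup reps i ∼ factorAt t m) (sym same) (∼-sym (factorAt∼class t))))

  module MiddleMap {n a b} (classesₙ : Classification n a) (classesₙ₊₂ : Classification (2 + n) b) where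
    private
      module A = Classification classesₙ
      module B = Classification classesₙ₊₂

    middle : Fin b → Fin a
    middle j = A.class (suc (B.position j))

    prefix-class : Fin a
    prefix-class = A.class 0

    middle-class : ∀ t → middle (B.class t) ≡ A.class (suc t)
    middle-class t = A.Match⇒class≡ (Match-middle (B.class≡⇒Match (B.class∘position (B.class t))))

    middle-covers-non-prefix : ∀ i → i ≢ prefix-class → ∃ λ j → middle j ≡ i
    middle-covers-non-prefix i i≢prefix with A.position i | A.class∘position i
    ... | zero  | prefix≡i = ⊥-elim (i≢prefix (sym prefix≡i))
    ... | suc t | class≡i  = B.class t , trans (middle-class t) class≡i

    injective-middle-hits-prefix : Injective _≡_ _≡_ middle → ¬ ¬ ∃ λ j → middle j ≡ prefix-class
    injective-middle-hits-prefix middle-injective misses =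
      ℕ→Fin-notInjective A.class (injective-if-collisions-descend A.class descend prefix-unique)
      where
      descend : ∀ s t → A.class (suc s) ≡ A.class (suc t) →
        A.class s ≡ A.class t ⊎ (A.class s ≡ A.class (2 + t) × A.class (2 + s) ≡ A.class t)
      descend s t same = Sum.map A.Match⇒class≡ (Product.map A.Match⇒class≡ A.Match⇒class≡)
        (Match-split (B.class≡⇒Match (middle-injective
          (trans (middle-class s) (trans same (sym (middle-class t)))))))

      prefix-unique : ∀ t → prefix-class ≢ A.class (suc t)
      prefix-unique t same = misses (B.class t , trans (middle-class t) (sym same))

theorem3p17 : ∀ {k} (x : Seq k) (n a b : ℕ) →
    RCount x n a → RCount x (n + 2) b → a ≤ b
theorem3p17 x n a b rₙ rₙ₊₂ =
  almost-surjective⇒≤ middle prefix-class middle-covers-non-prefix injective-middle-hits-prefix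
  where
  open Occurrences x
  open MiddleMap (classify rₙ) (classify (subst (λ m → RCount x m b) (+-comm n 2) rₙ₊₂))
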